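{- Let $m\geq 2$ be an integer and let $H$ be a normalized symmetric real Hadamard matrix of order $4m$. Let \[b=-1+\frac{1}{2m-2}\pm\mathbf{i}\frac{\sqrt{4m-5}}{2m-2}\] (either choice of sign). Delete the first row and first column of $H$, and in the resulting $(4m-1)\times(4m-1)$ matrix replace every off-diagonal entry $-1$ with $b$ and every diagonal entry $1$ with $-b$ (off-diagonal entries $1$ and diagonal entries $-1$ are kept unchanged). The resulting matrix is a complex Hadamard matrix of order $4m-1$.
   Context: A complex Hadamard matrix of order $n$ is an $n\times n$ matrix $H$ with unimodular complex entries satisfying $HH^\ast=nI$; a real Hadamard matrix is one with entries $\pm1$. A Hadamard matrix is normalized if all entries of its first row and first column equal $1$. -}

module Defs where

open import Data.Nat using (ℕ; zero; suc)
import Data.Nat as ℕ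
open import Data.Fin using (Fin; zero; suc)
import Data.Fin
open import Data.Integer as ℤ using (ℤ; +_; -[1+_])
open import Data.Rational as ℚ using (ℚ; 0ℚ; 1ℚ)
open import Data.Bool using (Bool; true; false; if_then_else_)
open import Data.Sum using (_⊎_)
open import Data.Product using (_×_; _,_; proj₁; proj₂)
open import Relation.Binary.PropositionalEquality using (_≡_; _≢_)
open import Relation.Nullary using (yes; no)

sumℤ : ∀ n → (Fin n → ℤ) → ℤ
sumℤ zero    f = + 0
sumℤ (suc n) f = f zero ℤ.+ sumℤ n (λ k → f (suc k))

RMat : ℕ → Set
RMat n = Fin n → Fin n → ℤ

IsRealHadamard : ∀ n → RMat n → Set
IsRealHadamard n H =
  (∀ i j → H i j ≡ + 1 ⊎ H i j ≡ -[1+ 0 ])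
  × (∀ i → sumℤ n (λ k → H i k ℤ.* H i k) ≡ + n)
  × (∀ i j → i ≢ j → sumℤ n (λ k → H i k ℤ.* H j k) ≡ + 0)

IsSymmetric : ∀ n → RMat n → Set
IsSymmetric n H = ∀ i j → H i j ≡ H j i

IsNormalized : ∀ n → RMat (suc n) → Set
IsNormalized n H = (∀ j → H zero j ≡ + 1) × (∀ i → H i zero ≡ + 1)

-- The imaginary quadratic field  ℚ(√-d) ⊆ ℂ  (d a positive integer),
-- element  (p , q)  standing for the complex number  p + q·i·√d.

ℚ√- : ℕ → Set
ℚ√- d = ℚ × ℚ

module Quad (d : ℕ) where
  dℚ : ℚ
  dℚ = (+ d) ℚ./ 1

  embℤ : ℤ → ℚ√- d
  embℤ x = (x ℚ./ 1 , 0ℚ)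

  zeroC oneC : ℚ√- d
  zeroC = (0ℚ , 0ℚ)
  oneC  = (1ℚ , 0ℚ)

  _+C_ : ℚ√- d → ℚ√- d → ℚ√- d
  (a , b) +C (c , e) = (a ℚ.+ c , b ℚ.+ e)

  -- (a + b·i√d)(c + e·i√d) = (ac - d·be) + (ae + bc)·i√d
  _*C_ : ℚ√- d → ℚ√- d → ℚ√- d
  (a , b) *C (c , e) = (a ℚ.* c ℚ.- dℚ ℚ.* (b ℚ.* e) , a ℚ.* e ℚ.+ b ℚ.* c)

  negC : ℚ√- d → ℚ√- d
  negC (a , b) = (ℚ.- a , ℚ.- b)

  conj : ℚ√- d → ℚ√- d
  conj (a , b) = (a , ℚ.- b)

  sumC : ∀ n → (Fin n → ℚ√- d) → ℚ√- d
  sumC zero    f = zeroC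
  sumC (suc n) f = f zero +C sumC n (λ k → f (suc k))

  IsComplexHadamard : ∀ n → (Fin n → Fin n → ℚ√- d) → Set
  IsComplexHadamard n M =
    (∀ i j → M i j *C conj (M i j) ≡ oneC)
    × (∀ i → sumC n (λ k → M i k *C conj (M i k)) ≡ embℤ (+ n))
    × (∀ i j → i ≢ j → sumC n (λ k → M i k *C conj (M j k)) ≡ zeroC)

-- The parameter  d = 4m - 5  and
--   b = -1 + 1/(2m-2) ± i·√(4m-5)/(2m-2)
-- written in the basis (1, i√d): real part -1 + 1/(2m-2), coefficient ±1/(2m-2).
-- Only meaningful for m ≥ 2 (junk value for m < 2).

dOf : ℕ → ℕ
dOf m = 4 ℕ.* m ℕ.∸ 5

bVal : (m : ℕ) → Bool → ℚ√- (dOf m)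
bVal (suc (suc k)) sgn =
  ( -[1+ 0 ] ℚ./ 1 ℚ.+ (+ 1) ℚ./ (2 ℕ.* suc k)
  , (if sgn then + 1 else -[1+ 0 ]) ℚ./ (2 ℕ.* suc k) )
bVal _ _ = (0ℚ , 0ℚ)

construct : (m n : ℕ) → Bool → RMat (suc n) → Fin n → Fin n → ℚ√- (dOf m)
construct m n sgn H i j with i Data.Fin.≟ j | H (suc i) (suc j) ℤ.≟ + 1
... | yes _ | yes _ = Quad.negC (dOf m) (bVal m sgn)
... | yes _ | no  _ = Quad.embℤ (dOf m) (H (suc i) (suc j))
... | no  _ | yes _ = Quad.embℤ (dOf m) (H (suc i) (suc j))
... | no  _ | no  _ = bVal m sgn

-- Let X be the core of H (H without its first row and column), so X is symmetric with
-- entries ±1, every row of X sums to -1 and distinct rows of X have inner product -1.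
-- The replacement rule is affine in the entries: 2M = (1 + b)(J - 2I) + (1 - b)X.
-- Expanding 4MM*, the mixed terms carry the factor (1 + b)(1 - b̄) + (1 - b)(1 + b̄) = 2(1 - |b|²),
-- which vanishes because |b| = 1; what is left off the diagonal is
-- (n - 3)(b + b̄) + 2(n - 5), and the real part of b is chosen exactly to make this zero.

module Submission where

open import Defs
open import Algebra.Bundles using (CommutativeRing)
open import Algebra.Consequences.Propositional using (comm∧idˡ⇒id; comm∧invˡ⇒inv; comm∧distrˡ⇒distrʳ)
import Algebra.Properties.CommutativeSemigroup as CommutativeSemigroupProperties
import Algebra.Solver.Ring as RingSolver
import Algebra.Solver.Ring.AlmostCommutativeRing as ACR
open import Algebra.Structures using (IsCommutativeRing)
open import Data.Bool using (Bool; true; false; if_then_else_)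
open import Data.Empty using (⊥-elim)
open import Data.Fin as Fin using (Fin; zero; suc)
import Data.Fin.Properties as FinP
open import Data.Integer as ℤ using (ℤ; +_; -[1+_])
import Data.Integer.Properties as ℤP
open import Data.Integer.Tactic.RingSolver using () renaming (ring to ℤ-ring)
open import Data.List using (_∷_; [])
open import Data.Maybe using (Maybe; just; nothing)
open import Data.Nat as ℕ using (ℕ; zero; suc; _≤_; _*_; s≤s; z≤n)
import Data.Nat.Properties as ℕP
open import Data.Nat.Tactic.RingSolver using () renaming (ring to ℕ-ring)
open import Data.Product using (_,_; proj₁)
open import Data.Rational as ℚ using (ℚ; 0ℚ; 1ℚ)
import Data.Rational.Properties as ℚP
import Data.Rational.Solver
open import Algebra.Properties.Group ℚP.+-0-group using (⁻¹-involutive)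
open import Data.Rational.Unnormalised as ℚᵘ using (ℚᵘ; mkℚᵘ; *≡*)
import Data.Rational.Unnormalised.Properties as ℚᵘP
open import Data.Sum using (_⊎_; inj₁; inj₂)
open import Function using (_∘_)
open import Relation.Binary.PropositionalEquality
open import Relation.Nullary using (yes; no; does)
open import Tactic.RingSolver using (solve; solve-∀)
import Tactic.RingSolver.Core.AlmostCommutativeRing as Tactic

fromℚᵘ-homo-+ : ∀ (p q : ℚᵘ) → ℚ.fromℚᵘ (p ℚᵘ.+ q) ≡ ℚ.fromℚᵘ p ℚ.+ ℚ.fromℚᵘ q
fromℚᵘ-homo-+ p q = ℚP.toℚᵘ-injective (begin-equality
  ℚ.toℚᵘ (ℚ.fromℚᵘ (p ℚᵘ.+ q))                   ≃⟨ ℚP.toℚᵘ-fromℚᵘ (p ℚᵘ.+ q) ⟩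
  p ℚᵘ.+ q                                        ≃⟨ ℚᵘP.+-cong (ℚP.toℚᵘ-fromℚᵘ p) (ℚP.toℚᵘ-fromℚᵘ q) ⟨
  ℚ.toℚᵘ (ℚ.fromℚᵘ p) ℚᵘ.+ ℚ.toℚᵘ (ℚ.fromℚᵘ q)   ≃⟨ ℚP.toℚᵘ-homo-+ (ℚ.fromℚᵘ p) (ℚ.fromℚᵘ q) ⟨
  ℚ.toℚᵘ (ℚ.fromℚᵘ p ℚ.+ ℚ.fromℚᵘ q)             ∎)
  where open ℚᵘP.≤-Reasoning

fromℚᵘ-homo-* : ∀ (p q : ℚᵘ) → ℚ.fromℚᵘ (p ℚᵘ.* q) ≡ ℚ.fromℚᵘ p ℚ.* ℚ.fromℚᵘ q
fromℚᵘ-homo-* p q = ℚP.toℚᵘ-injective (begin-equality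
  ℚ.toℚᵘ (ℚ.fromℚᵘ (p ℚᵘ.* q))                   ≃⟨ ℚP.toℚᵘ-fromℚᵘ (p ℚᵘ.* q) ⟩
  p ℚᵘ.* q                                        ≃⟨ ℚᵘP.*-cong (ℚP.toℚᵘ-fromℚᵘ p) (ℚP.toℚᵘ-fromℚᵘ q) ⟨
  ℚ.toℚᵘ (ℚ.fromℚᵘ p) ℚᵘ.* ℚ.toℚᵘ (ℚ.fromℚᵘ q)   ≃⟨ ℚP.toℚᵘ-homo-* (ℚ.fromℚᵘ p) (ℚ.fromℚᵘ q) ⟨
  ℚ.toℚᵘ (ℚ.fromℚᵘ p ℚ.* ℚ.fromℚᵘ q)             ∎)
  where open ℚᵘP.≤-Reasoning

ι : ℤ → ℚ
ι z = z ℚ./ 1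

ι-+ : ∀ a b → ι (a ℤ.+ b) ≡ ι a ℚ.+ ι b
ι-+ a b = trans (ℚP.fromℚᵘ-cong {mkℚᵘ (a ℤ.+ b) 0} {mkℚᵘ a 0 ℚᵘ.+ mkℚᵘ b 0} (*≡* (cross-multiplied a b)))
                (fromℚᵘ-homo-+ (mkℚᵘ a 0) (mkℚᵘ b 0))
  where
  cross-multiplied : ∀ a b → (a ℤ.+ b) ℤ.* + 1 ≡ (a ℤ.* + 1 ℤ.+ b ℤ.* + 1) ℤ.* + 1
  cross-multiplied = solve-∀ ℤ-ring

ι-* : ∀ a b → ι (a ℤ.* b) ≡ ι a ℚ.* ι b
ι-* a b = fromℚᵘ-homo-* (mkℚᵘ a 0) (mkℚᵘ b 0)

ι-neg : ∀ a → ι (ℤ.- a) ≡ ℚ.- ι a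
ι-neg (+ zero)  = refl
ι-neg (+ suc n) = refl
ι-neg -[1+ n ]  = sym (⁻¹-involutive (ι (+ suc n)))

ι-*-1/ : ∀ a → ι (+ suc a) ℚ.* ((+ 1) ℚ./ suc a) ≡ 1ℚ
ι-*-1/ a = trans (sym (fromℚᵘ-homo-* (mkℚᵘ (+ suc a) 0) (mkℚᵘ (+ 1) a)))
                 (ℚP.fromℚᵘ-cong {mkℚᵘ (+ suc a) 0 ℚᵘ.* mkℚᵘ (+ 1) a} {ℚᵘ.1ℚᵘ} (*≡* (cong +_ (cross-multiplied a))))
  where
  cross-multiplied : ∀ a → suc a * 1 * 1 ≡ 1 * suc (a ℕ.+ 0)
  cross-multiplied = solve-∀ ℕ-ring

ι-+ℕ : ∀ a b → ι (+ (a ℕ.+ b)) ≡ ι (+ a) ℚ.+ ι (+ b)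
ι-+ℕ a b = trans (cong ι (ℤP.pos-+ a b)) (ι-+ (+ a) (+ b))

-- Integer vectors and the matrix J - 2I

infix 8 _·_

_·_ : ∀ {n} → (Fin n → ℤ) → (Fin n → ℤ) → ℤ
_·_ {n} u v = sumℤ n (λ k → u k ℤ.* v k)

sumℤ-cong : ∀ n {f g : Fin n → ℤ} → (∀ k → f k ≡ g k) → sumℤ n f ≡ sumℤ n g
sumℤ-cong zero    f≗g = refl
sumℤ-cong (suc n) f≗g = cong₂ ℤ._+_ (f≗g zero) (sumℤ-cong n (λ k → f≗g (suc k)))

sumℤ-ones : ∀ n → sumℤ n (λ _ → + 1) ≡ + n
sumℤ-ones zero    = refl
sumℤ-ones (suc n) = cong (ℤ._+_ (+ 1)) (sumℤ-ones n)

·-comm : ∀ {n} (u v : Fin n → ℤ) → u · v ≡ v · u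
·-comm {n} u v = sumℤ-cong n (λ k → ℤP.*-comm (u k) (v k))

J-2I : ∀ {n} → Fin n → Fin n → ℤ
J-2I i k = if does (i Fin.≟ k) then -[1+ 0 ] else + 1

J-2I-≢ : ∀ {n} {i k : Fin n} → i ≢ k → J-2I i k ≡ + 1
J-2I-≢ {i = i} {k} i≢k with i Fin.≟ k
... | yes i≡k = ⊥-elim (i≢k i≡k)
... | no _    = refl

J-2I-· : ∀ n (i : Fin n) (w : Fin n → ℤ) → J-2I i · w ≡ sumℤ n w ℤ.- + 2 ℤ.* w i
J-2I-· (suc n) zero w = begin
  -[1+ 0 ] ℤ.* w zero ℤ.+ sumℤ n (λ k → + 1 ℤ.* w (suc k))
    ≡⟨ cong (ℤ._+_ (-[1+ 0 ] ℤ.* w zero)) (sumℤ-cong n (λ k → ℤP.*-identityˡ (w (suc k)))) ⟩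
  -[1+ 0 ] ℤ.* w zero ℤ.+ sumℤ n (λ k → w (suc k))
    ≡⟨ rearrange (w zero) (sumℤ n (λ k → w (suc k))) ⟩
  w zero ℤ.+ sumℤ n (λ k → w (suc k)) ℤ.- + 2 ℤ.* w zero ∎
  where
  open ≡-Reasoning
  rearrange : ∀ a s → -[1+ 0 ] ℤ.* a ℤ.+ s ≡ a ℤ.+ s ℤ.- + 2 ℤ.* a
  rearrange = solve-∀ ℤ-ring
J-2I-· (suc n) (suc i) w = begin
  + 1 ℤ.* w zero ℤ.+ J-2I i · (λ k → w (suc k))
    ≡⟨ cong (ℤ._+_ (+ 1 ℤ.* w zero)) (J-2I-· n i (λ k → w (suc k))) ⟩
  + 1 ℤ.* w zero ℤ.+ (sumℤ n (λ k → w (suc k)) ℤ.- + 2 ℤ.* w (suc i))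
    ≡⟨ rearrange (w zero) (sumℤ n (λ k → w (suc k))) (w (suc i)) ⟩
  w zero ℤ.+ sumℤ n (λ k → w (suc k)) ℤ.- + 2 ℤ.* w (suc i) ∎
  where
  open ≡-Reasoning
  rearrange : ∀ a s c → + 1 ℤ.* a ℤ.+ (s ℤ.- + 2 ℤ.* c) ≡ a ℤ.+ s ℤ.- + 2 ℤ.* c
  rearrange = solve-∀ ℤ-ring

sumℤ-J-2I : ∀ n (i : Fin n) → sumℤ n (J-2I i) ≡ + n ℤ.- + 2
sumℤ-J-2I n i = begin
  sumℤ n (J-2I i)                      ≡⟨ sumℤ-cong n (λ k → ℤP.*-identityʳ (J-2I i k)) ⟨
  J-2I i · (λ _ → + 1)                 ≡⟨ J-2I-· n i (λ _ → + 1) ⟩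
  sumℤ n (λ _ → + 1) ℤ.- + 2           ≡⟨ cong (ℤ._- + 2) (sumℤ-ones n) ⟩
  + n ℤ.- + 2                          ∎
  where open ≡-Reasoning

J-2I-·-J-2I : ∀ n {i j : Fin n} → i ≢ j → J-2I i · J-2I j ≡ + n ℤ.- + 4
J-2I-·-J-2I n {i} {j} i≢j = begin
  J-2I i · J-2I j                                  ≡⟨ J-2I-· n i (J-2I j) ⟩
  sumℤ n (J-2I j) ℤ.- + 2 ℤ.* J-2I j i              ≡⟨ cong₂ (λ s e → s ℤ.- + 2 ℤ.* e) (sumℤ-J-2I n j) (J-2I-≢ (i≢j ∘ sym)) ⟩
  + n ℤ.- + 2 ℤ.- + 2 ℤ.* + 1                      ≡⟨ rearrange (+ n) ⟩
  + n ℤ.- + 4                                      ∎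
  where
  open ≡-Reasoning
  rearrange : ∀ N → N ℤ.- + 2 ℤ.- + 2 ℤ.* + 1 ≡ N ℤ.- + 4
  rearrange = solve-∀ ℤ-ring

J-2I-·-symmetric : ∀ n (x : Fin n → Fin n → ℤ) → (∀ i j → x i j ≡ x j i) →
  (∀ i → sumℤ n (x i) ≡ -[1+ 0 ]) → ∀ i j → J-2I i · x j ≡ x i · J-2I j
J-2I-·-symmetric n x symmetric rowSum i j = begin
  J-2I i · x j                                ≡⟨ J-2I-· n i (x j) ⟩
  sumℤ n (x j) ℤ.- + 2 ℤ.* x j i              ≡⟨ cong₂ (λ s e → s ℤ.- + 2 ℤ.* e) (trans (rowSum j) (sym (rowSum i))) (symmetric j i) ⟩
  sumℤ n (x i) ℤ.- + 2 ℤ.* x i j              ≡⟨ J-2I-· n j (x i) ⟨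
  J-2I j · x i                                ≡⟨ ·-comm (J-2I j) (x i) ⟩
  x i · J-2I j                                ∎
  where open ≡-Reasoning

-- The core of a normalized Hadamard matrix

core : ∀ {n} → RMat (suc n) → Fin n → Fin n → ℤ
core H i j = H (suc i) (suc j)

1+s≡0⇒s≡-1 : ∀ s → + 1 ℤ.+ s ≡ + 0 → s ≡ -[1+ 0 ]
1+s≡0⇒s≡-1 s 1+s≡0 = trans (shift s) (cong (ℤ._+ -[1+ 0 ]) 1+s≡0)
  where
  shift : ∀ s → s ≡ + 1 ℤ.+ s ℤ.+ -[1+ 0 ]
  shift = solve-∀ ℤ-ring

core-rowSum : ∀ {n} {H : RMat (suc n)} → IsRealHadamard (suc n) H → IsNormalized n H →
  ∀ i → sumℤ n (core H i) ≡ -[1+ 0 ]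
core-rowSum {n} {H} (_ , _ , orthogonal) (row₀ , col₀) i = 1+s≡0⇒s≡-1 _ (begin
  + 1 ℤ.+ sumℤ n (core H i)
    ≡⟨ cong₂ ℤ._+_ (cong₂ ℤ._*_ (col₀ (suc i)) (row₀ zero))
                   (sumℤ-cong n (λ k → trans (cong (core H i k ℤ.*_) (row₀ (suc k))) (ℤP.*-identityʳ _))) ⟨
  sumℤ (suc n) (λ k → H (suc i) k ℤ.* H zero k)
    ≡⟨ orthogonal (suc i) zero (λ ()) ⟩
  + 0 ∎)
  where open ≡-Reasoning

core-orthogonal : ∀ {n} {H : RMat (suc n)} → IsRealHadamard (suc n) H → IsNormalized n H →
  ∀ {i j} → i ≢ j → core H i · core H j ≡ -[1+ 0 ]
core-orthogonal {n} {H} (_ , _ , orthogonal) (_ , col₀) {i} {j} i≢j = 1+s≡0⇒s≡-1 _ (begin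
  + 1 ℤ.+ core H i · core H j
    ≡⟨ cong (ℤ._+ core H i · core H j) (cong₂ ℤ._*_ (col₀ (suc i)) (col₀ (suc j))) ⟨
  sumℤ (suc n) (λ k → H (suc i) k ℤ.* H (suc j) k)
    ≡⟨ orthogonal (suc i) (suc j) (i≢j ∘ FinP.suc-injective) ⟩
  + 0 ∎)
  where open ≡-Reasoning

-- The ring ℚ(√-d)

module QuadraticRing (d : ℕ) where
  open Quad d

  private
    module ℚ-Solver = Data.Rational.Solver.+-*-Solver

  open ℚ-Solver using (_:+_; _:*_; _:-_; :-_; _:=_; con)

  +C-assoc : ∀ x y z → (x +C y) +C z ≡ x +C (y +C z)
  +C-assoc (a , b) (c , e) (f , g) = cong₂ _,_ (ℚP.+-assoc a c f) (ℚP.+-assoc b e g)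

  +C-comm : ∀ x y → x +C y ≡ y +C x
  +C-comm (a , b) (c , e) = cong₂ _,_ (ℚP.+-comm a c) (ℚP.+-comm b e)

  +C-identityˡ : ∀ x → zeroC +C x ≡ x
  +C-identityˡ (a , b) = cong₂ _,_ (ℚP.+-identityˡ a) (ℚP.+-identityˡ b)

  +C-inverseˡ : ∀ x → negC x +C x ≡ zeroC
  +C-inverseˡ (a , b) = cong₂ _,_ (ℚP.+-inverseˡ a) (ℚP.+-inverseˡ b)

  *C-assoc : ∀ x y z → (x *C y) *C z ≡ x *C (y *C z)
  *C-assoc (a , b) (c , e) (f , g) = cong₂ _,_
    (ℚ-Solver.solve 7 (λ a b c e f g D →
        (a :* c :- D :* (b :* e)) :* f :- D :* ((a :* e :+ b :* c) :* g)
      := a :* (c :* f :- D :* (e :* g)) :- D :* (b :* (c :* g :+ e :* f))) refl a b c e f g dℚ)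
    (ℚ-Solver.solve 7 (λ a b c e f g D →
        (a :* c :- D :* (b :* e)) :* g :+ (a :* e :+ b :* c) :* f
      := a :* (c :* g :+ e :* f) :+ b :* (c :* f :- D :* (e :* g))) refl a b c e f g dℚ)

  *C-comm : ∀ x y → x *C y ≡ y *C x
  *C-comm (a , b) (c , e) = cong₂ _,_
    (ℚ-Solver.solve 5 (λ a b c e D → a :* c :- D :* (b :* e) := c :* a :- D :* (e :* b)) refl a b c e dℚ)
    (ℚ-Solver.solve 4 (λ a b c e → a :* e :+ b :* c := c :* b :+ e :* a) refl a b c e)

  *C-identityˡ : ∀ x → oneC *C x ≡ x
  *C-identityˡ (a , b) = cong₂ _,_
    (ℚ-Solver.solve 3 (λ a b D → con 1ℚ :* a :- D :* (con 0ℚ :* b) := a) refl a b dℚ)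
    (ℚ-Solver.solve 2 (λ a b → con 1ℚ :* b :+ con 0ℚ :* a := b) refl a b)

  *C-distribˡ-+C : ∀ x y z → x *C (y +C z) ≡ (x *C y) +C (x *C z)
  *C-distribˡ-+C (a , b) (c , e) (f , g) = cong₂ _,_
    (ℚ-Solver.solve 7 (λ a b c e f g D →
        a :* (c :+ f) :- D :* (b :* (e :+ g)) := (a :* c :- D :* (b :* e)) :+ (a :* f :- D :* (b :* g)))
      refl a b c e f g dℚ)
    (ℚ-Solver.solve 6 (λ a b c e f g →
        a :* (e :+ g) :+ b :* (c :+ f) := (a :* e :+ b :* c) :+ (a :* g :+ b :* f)) refl a b c e f g)

  isCommutativeRing : IsCommutativeRing _≡_ _+C_ _*C_ negC zeroC oneC
  isCommutativeRing = record
    { isRing = record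
      { +-isAbelianGroup = record
        { isGroup = record
          { isMonoid = record
            { isSemigroup = record
              { isMagma = record { isEquivalence = isEquivalence ; ∙-cong = cong₂ _+C_ }
              ; assoc = +C-assoc }
            ; identity = comm∧idˡ⇒id +C-comm +C-identityˡ }
          ; inverse = comm∧invˡ⇒inv +C-comm +C-inverseˡ
          ; ⁻¹-cong = cong negC }
        ; comm = +C-comm }
      ; *-cong = cong₂ _*C_
      ; *-assoc = *C-assoc
      ; *-identity = comm∧idˡ⇒id *C-comm *C-identityˡ
      ; distrib = *C-distribˡ-+C , comm∧distrˡ⇒distrʳ *C-comm *C-distribˡ-+C }
    ; *-comm = *C-comm }

  commutativeRing : CommutativeRing _ _
  commutativeRing = record { isCommutativeRing = isCommutativeRing }

  embℤ-+ : ∀ a b → embℤ (a ℤ.+ b) ≡ embℤ a +C embℤ b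
  embℤ-+ a b = cong (_, 0ℚ) (ι-+ a b)

  embℤ-* : ∀ a b → embℤ (a ℤ.* b) ≡ embℤ a *C embℤ b
  embℤ-* a b = cong₂ _,_
    (trans (ι-* a b) (ℚ-Solver.solve 3 (λ A B D → A :* B := A :* B :- D :* (con 0ℚ :* con 0ℚ)) refl (ι a) (ι b) dℚ))
    (ℚ-Solver.solve 2 (λ A B → con 0ℚ := A :* con 0ℚ :+ con 0ℚ :* B) refl (ι a) (ι b))

  embℤ-neg : ∀ a → embℤ (ℤ.- a) ≡ negC (embℤ a)
  embℤ-neg a = cong (_, 0ℚ) (ι-neg a)

  embℤ-morphism : ACR._-Raw-AlmostCommutative⟶_ (CommutativeRing.rawRing ℤP.+-*-commutativeRing)
                    (ACR.fromCommutativeRing commutativeRing)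
  embℤ-morphism = record
    { ⟦_⟧ = embℤ ; +-homo = embℤ-+ ; *-homo = embℤ-* ; -‿homo = embℤ-neg ; 0-homo = refl ; 1-homo = refl }

  embℤ-≟ : ∀ a b → Maybe (embℤ a ≡ embℤ b)
  embℤ-≟ a b with a ℤ.≟ b
  ... | yes a≡b = just (cong embℤ a≡b)
  ... | no _    = nothing

  module ℚ√-Solver = RingSolver (CommutativeRing.rawRing ℤP.+-*-commutativeRing)
    (ACR.fromCommutativeRing commutativeRing) embℤ-morphism embℤ-≟

  open ℚ√-Solver public using () renaming (_:+_ to _⊕_; _:*_ to _⊗_; _:-_ to _⊖_; :-_ to ⊝_; _:=_ to _⊜_; con to κ)

  conj-+C : ∀ x y → conj (x +C y) ≡ conj x +C conj y
  conj-+C (a , b) (c , e) = cong (a ℚ.+ c ,_) (ℚP.neg-distrib-+ b e)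

  conj-*C : ∀ x y → conj (x *C y) ≡ conj x *C conj y
  conj-*C (a , b) (c , e) = cong₂ _,_
    (ℚ-Solver.solve 5 (λ a b c e D → a :* c :- D :* (b :* e) := a :* c :- D :* ((:- b) :* (:- e))) refl a b c e dℚ)
    (ℚ-Solver.solve 4 (λ a b c e → :- (a :* e :+ b :* c) := a :* (:- e) :+ (:- b) :* c) refl a b c e)

  conj-linear : ∀ p q a c → conj ((p *C embℤ a) +C (q *C embℤ c)) ≡ (conj p *C embℤ a) +C (conj q *C embℤ c)
  conj-linear p q a c = trans (conj-+C (p *C embℤ a) (q *C embℤ c)) (cong₂ _+C_ (conj-*C p (embℤ a)) (conj-*C q (embℤ c)))

  embℤ-±1-unimodular : ∀ z → z ≡ + 1 ⊎ z ≡ -[1+ 0 ] → embℤ z *C conj (embℤ z) ≡ oneC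
  embℤ-±1-unimodular _ (inj₁ refl) = ℚ√-Solver.solve 0 (κ (+ 1) ⊗ κ (+ 1) ⊜ κ (+ 1)) refl
  embℤ-±1-unimodular _ (inj₂ refl) = ℚ√-Solver.solve 0 (κ -[1+ 0 ] ⊗ κ -[1+ 0 ] ⊜ κ (+ 1)) refl

  negC-*C-negC : ∀ x y → negC x *C negC y ≡ x *C y
  negC-*C-negC = ℚ√-Solver.solve 2 (λ x y → ⊝ x ⊗ ⊝ y ⊜ x ⊗ y) refl

  open CommutativeRing commutativeRing using (zeroʳ; distribˡ; +-commutativeSemigroup)
  open CommutativeSemigroupProperties +-commutativeSemigroup using (interchange)

  sumC-cong : ∀ n {f g : Fin n → ℚ√- d} → (∀ k → f k ≡ g k) → sumC n f ≡ sumC n g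
  sumC-cong zero    f≗g = refl
  sumC-cong (suc n) f≗g = cong₂ _+C_ (f≗g zero) (sumC-cong n (λ k → f≗g (suc k)))

  sumC-+C : ∀ n (f g : Fin n → ℚ√- d) → sumC n (λ k → f k +C g k) ≡ sumC n f +C sumC n g
  sumC-+C zero    f g = sym (+C-identityˡ zeroC)
  sumC-+C (suc n) f g = trans (cong ((f zero +C g zero) +C_) (sumC-+C n (λ k → f (suc k)) (λ k → g (suc k))))
                              (interchange (f zero) (g zero) (sumC n (λ k → f (suc k))) (sumC n (λ k → g (suc k))))

  sumC-*Cˡ : ∀ n c (f : Fin n → ℚ√- d) → sumC n (λ k → c *C f k) ≡ c *C sumC n f
  sumC-*Cˡ zero    c f = sym (zeroʳ c)
  sumC-*Cˡ (suc n) c f = trans (cong ((c *C f zero) +C_) (sumC-*Cˡ n c (λ k → f (suc k))))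
                               (sym (distribˡ c (f zero) (sumC n (λ k → f (suc k)))))

  embℤ-sumℤ : ∀ n (w : Fin n → ℤ) → embℤ (sumℤ n w) ≡ sumC n (λ k → embℤ (w k))
  embℤ-sumℤ zero    w = refl
  embℤ-sumℤ (suc n) w = trans (embℤ-+ (w zero) (sumℤ n (λ k → w (suc k))))
                              (cong (embℤ (w zero) +C_) (embℤ-sumℤ n (λ k → w (suc k))))

  sumC-*embℤ : ∀ n c (w : Fin n → ℤ) → sumC n (λ k → c *C embℤ (w k)) ≡ c *C embℤ (sumℤ n w)
  sumC-*embℤ n c w = trans (sumC-*Cˡ n c (λ k → embℤ (w k))) (cong (c *C_) (sym (embℤ-sumℤ n w)))

  sumC-bilinear : ∀ n p q p' q' (u v u' v' : Fin n → ℤ) →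
    sumC n (λ k → ((p *C embℤ (u k)) +C (q *C embℤ (v k))) *C ((p' *C embℤ (u' k)) +C (q' *C embℤ (v' k))))
    ≡ ((p *C p') *C embℤ (u · u')) +C (((p *C q') *C embℤ (u · v'))
      +C (((q *C p') *C embℤ (v · u')) +C ((q *C q') *C embℤ (v · v'))))
  sumC-bilinear n p q p' q' u v u' v' =
    trans (sumC-cong n (λ k → expand (u k) (v k) (u' k) (v' k)))
    (trans (peel (p *C p') (λ k → u k ℤ.* u' k) _) (cong (((p *C p') *C embℤ (u · u')) +C_)
    (trans (peel (p *C q') (λ k → u k ℤ.* v' k) _) (cong (((p *C q') *C embℤ (u · v')) +C_)
    (trans (peel (q *C p') (λ k → v k ℤ.* u' k) _) (cong (((q *C p') *C embℤ (v · u')) +C_)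
    (sumC-*embℤ n (q *C q') (λ k → v k ℤ.* v' k))))))))
    where
    peel : ∀ c (w : Fin n → ℤ) f → sumC n (λ k → (c *C embℤ (w k)) +C f k) ≡ (c *C embℤ (sumℤ n w)) +C sumC n f
    peel c w f = trans (sumC-+C n (λ k → c *C embℤ (w k)) f) (cong (_+C sumC n f) (sumC-*embℤ n c w))

    expand : ∀ a b a' b' →
      ((p *C embℤ a) +C (q *C embℤ b)) *C ((p' *C embℤ a') +C (q' *C embℤ b'))
      ≡ ((p *C p') *C embℤ (a ℤ.* a')) +C (((p *C q') *C embℤ (a ℤ.* b'))
        +C (((q *C p') *C embℤ (b ℤ.* a')) +C ((q *C q') *C embℤ (b ℤ.* b'))))
    expand a b a' b' = trans
      (ℚ√-Solver.solve 8 (λ p q p' q' A B A' B' →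
          (p ⊗ A ⊕ q ⊗ B) ⊗ (p' ⊗ A' ⊕ q' ⊗ B')
        ⊜ p ⊗ p' ⊗ (A ⊗ A') ⊕ (p ⊗ q' ⊗ (A ⊗ B') ⊕ (q ⊗ p' ⊗ (B ⊗ A') ⊕ q ⊗ q' ⊗ (B ⊗ B'))))
        refl p q p' q' (embℤ a) (embℤ b) (embℤ a') (embℤ b'))
      (sym (cong₂ _+C_ (cong ((p *C p') *C_) (embℤ-* a a'))
           (cong₂ _+C_ (cong ((p *C q') *C_) (embℤ-* a b'))
           (cong₂ _+C_ (cong ((q *C p') *C_) (embℤ-* b a')) (cong ((q *C q') *C_) (embℤ-* b b'))))))

  embℚ : ℚ → ℚ√- d
  embℚ a = (a , 0ℚ)

  embℚ-* : ∀ a c → embℚ a *C embℚ c ≡ embℚ (a ℚ.* c)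
  embℚ-* a c = cong₂ _,_
    (ℚ-Solver.solve 3 (λ a c D → a :* c :- D :* (con 0ℚ :* con 0ℚ) := a :* c) refl a c dℚ)
    (ℚ-Solver.solve 2 (λ a c → a :* con 0ℚ :+ con 0ℚ :* c := con 0ℚ) refl a c)

  +C-conj : ∀ a v → (a , v) +C conj (a , v) ≡ embℚ (a ℚ.+ a)
  +C-conj a v = cong (a ℚ.+ a ,_) (ℚP.+-inverseʳ v)

  embℤ-suc-*C-cancel : ∀ a z → embℤ (+ suc a) *C z ≡ zeroC → z ≡ zeroC
  embℤ-suc-*C-cancel a z a*z≡0 = begin
    z                                  ≡⟨ *C-identityˡ z ⟨
    oneC *C z                          ≡⟨ cong (_*C z) inverse-* ⟨
    (inverse *C embℤ (+ suc a)) *C z   ≡⟨ *C-assoc inverse (embℤ (+ suc a)) z ⟩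
    inverse *C (embℤ (+ suc a) *C z)   ≡⟨ cong (inverse *C_) a*z≡0 ⟩
    inverse *C zeroC                   ≡⟨ zeroʳ inverse ⟩
    zeroC                              ∎
    where
    open ≡-Reasoning
    inverse : ℚ√- d
    inverse = embℚ ((+ 1) ℚ./ suc a)

    inverse-* : inverse *C embℤ (+ suc a) ≡ oneC
    inverse-* = trans (*C-comm inverse (embℤ (+ suc a)))
                      (trans (embℚ-* (ι (+ suc a)) ((+ 1) ℚ./ suc a)) (cong embℚ (ι-*-1/ a)))

  orthogonality-identity : ∀ β N B → β *C conj β ≡ oneC →
    (N +C negC (embℤ (+ 3))) *C (β +C conj β) ≡ embℤ (+ 2) *C (embℤ (+ 5) +C negC N) →
    (((oneC +C β) *C (oneC +C conj β)) *C (N +C embℤ -[1+ 3 ]))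
      +C ((((oneC +C β) *C (oneC +C negC (conj β))) *C B)
      +C ((((oneC +C negC β) *C (oneC +C conj β)) *C B)
      +C (((oneC +C negC β) *C (oneC +C negC (conj β))) *C embℤ -[1+ 0 ])))
    ≡ zeroC
  orthogonality-identity β N B unimodular trace = trans
    (ℚ√-Solver.solve 4 (λ b b̄ N B →
         (κ (+ 1) ⊕ b) ⊗ (κ (+ 1) ⊕ b̄) ⊗ (N ⊕ κ -[1+ 3 ])
       ⊕ ((κ (+ 1) ⊕ b) ⊗ (κ (+ 1) ⊕ ⊝ b̄) ⊗ B
       ⊕ ((κ (+ 1) ⊕ ⊝ b) ⊗ (κ (+ 1) ⊕ b̄) ⊗ B
       ⊕ (κ (+ 1) ⊕ ⊝ b) ⊗ (κ (+ 1) ⊕ ⊝ b̄) ⊗ κ -[1+ 0 ]))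
       ⊜ (N ⊕ ⊝ κ (+ 3)) ⊗ (b ⊕ b̄) ⊖ κ (+ 2) ⊗ (κ (+ 5) ⊕ ⊝ N)
       ⊕ (N ⊖ κ (+ 5) ⊖ κ (+ 2) ⊗ B) ⊗ (b ⊗ b̄ ⊖ κ (+ 1)))
      refl β (conj β) N B)
    (trans (cong₂ (λ X T → (X +C negC Y) +C (C *C (T +C negC oneC))) trace unimodular)
      (ℚ√-Solver.solve 2 (λ N B →
          κ (+ 2) ⊗ (κ (+ 5) ⊕ ⊝ N) ⊖ κ (+ 2) ⊗ (κ (+ 5) ⊕ ⊝ N)
        ⊕ (N ⊖ κ (+ 5) ⊖ κ (+ 2) ⊗ B) ⊗ (κ (+ 1) ⊖ κ (+ 1)) ⊜ κ (+ 0))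
        refl N B))
    where
    Y C : ℚ√- d
    Y = embℤ (+ 2) *C (embℤ (+ 5) +C negC N)
    C = (N +C negC (embℤ (+ 5))) +C negC (embℤ (+ 2) *C B)

ℚ-ring : Tactic.AlmostCommutativeRing _ _
ℚ-ring = Tactic.fromCommutativeRing ℚP.+-*-commutativeRing 0≟
  where
  0≟ : (p : ℚ) → Maybe (0ℚ ≡ p)
  0≟ p with 0ℚ ℚP.≟ p
  ... | yes 0≡p = just 0≡p
  ... | no _    = nothing

unimodular-re : ∀ D K u v → D ℚ.+ 1ℚ ≡ K ℚ.+ K → K ℚ.* u ≡ 1ℚ → v ℚ.* v ≡ u ℚ.* u →
  (ι -[1+ 0 ] ℚ.+ u) ℚ.* (ι -[1+ 0 ] ℚ.+ u) ℚ.- D ℚ.* (v ℚ.* ℚ.- v) ≡ 1ℚ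
unimodular-re D K u v D+1≡2K K*u≡1 v²≡u² = begin
  (ι -[1+ 0 ] ℚ.+ u) ℚ.* (ι -[1+ 0 ] ℚ.+ u) ℚ.- D ℚ.* (v ℚ.* ℚ.- v)
    ≡⟨ solve (D ∷ u ∷ v ∷ []) ℚ-ring ⟩
  1ℚ ℚ.- (u ℚ.+ u) ℚ.+ u ℚ.* u ℚ.+ (D ℚ.+ 1ℚ ℚ.- 1ℚ) ℚ.* (v ℚ.* v)
    ≡⟨ cong₂ (λ A V → 1ℚ ℚ.- (u ℚ.+ u) ℚ.+ u ℚ.* u ℚ.+ (A ℚ.- 1ℚ) ℚ.* V) D+1≡2K v²≡u² ⟩
  1ℚ ℚ.- (u ℚ.+ u) ℚ.+ u ℚ.* u ℚ.+ (K ℚ.+ K ℚ.- 1ℚ) ℚ.* (u ℚ.* u)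
    ≡⟨ solve (K ∷ u ∷ []) ℚ-ring ⟩
  1ℚ ℚ.+ (u ℚ.+ u) ℚ.* (K ℚ.* u ℚ.- 1ℚ)
    ≡⟨ cong (λ B → 1ℚ ℚ.+ (u ℚ.+ u) ℚ.* (B ℚ.- 1ℚ)) K*u≡1 ⟩
  1ℚ ℚ.+ (u ℚ.+ u) ℚ.* (1ℚ ℚ.- 1ℚ)
    ≡⟨ solve (u ∷ []) ℚ-ring ⟩
  1ℚ ∎
  where open ≡-Reasoning

unimodular-im : ∀ r v → r ℚ.* ℚ.- v ℚ.+ v ℚ.* r ≡ 0ℚ
unimodular-im = solve-∀ ℚ-ring

trace-re : ∀ N K u → N ≡ K ℚ.+ K ℚ.+ ι (+ 3) → K ℚ.* u ≡ 1ℚ →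
  (N ℚ.- ι (+ 3)) ℚ.* ((ι -[1+ 0 ] ℚ.+ u) ℚ.+ (ι -[1+ 0 ] ℚ.+ u)) ≡ ι (+ 2) ℚ.* (ι (+ 5) ℚ.- N)
trace-re N K u refl K*u≡1 = begin
  (K ℚ.+ K ℚ.+ ι (+ 3) ℚ.- ι (+ 3)) ℚ.* ((ι -[1+ 0 ] ℚ.+ u) ℚ.+ (ι -[1+ 0 ] ℚ.+ u))
    ≡⟨ solve (K ∷ u ∷ []) ℚ-ring ⟩
  ι (+ 2) ℚ.* (ι (+ 5) ℚ.- (K ℚ.+ K ℚ.+ ι (+ 3))) ℚ.+ ι (+ 4) ℚ.* (K ℚ.* u ℚ.- 1ℚ)
    ≡⟨ cong (λ B → ι (+ 2) ℚ.* (ι (+ 5) ℚ.- (K ℚ.+ K ℚ.+ ι (+ 3))) ℚ.+ ι (+ 4) ℚ.* (B ℚ.- 1ℚ)) K*u≡1 ⟩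
  ι (+ 2) ℚ.* (ι (+ 5) ℚ.- (K ℚ.+ K ℚ.+ ι (+ 3))) ℚ.+ ι (+ 4) ℚ.* (1ℚ ℚ.- 1ℚ)
    ≡⟨ solve (K ∷ []) ℚ-ring ⟩
  ι (+ 2) ℚ.* (ι (+ 5) ℚ.- (K ℚ.+ K ℚ.+ ι (+ 3))) ∎
  where open ≡-Reasoning

-- m = k + 2 and K = 2m - 2, so that d = 2K - 1, n = 2K + 3 and b = -1 + (1 ± i√d)/K.
module Parameter (k : ℕ) where
  open Quad (dOf (suc (suc k)))
  open QuadraticRing (dOf (suc (suc k)))

  K : ℕ
  K = 2 * suc k

  u : ℚ
  u = (+ 1) ℚ./ K

  K*u≡1 : ι (+ K) ℚ.* u ≡ 1ℚ
  K*u≡1 = ι-*-1/ (k ℕ.+ suc (k ℕ.+ 0))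

  d+1≡K+K : dOf (suc (suc k)) ℕ.+ 1 ≡ K ℕ.+ K
  d+1≡K+K = begin
    4 * suc (suc k) ℕ.∸ 5 ℕ.+ 1         ≡⟨ cong (λ t → t ℕ.∸ 5 ℕ.+ 1) 4m≡5+[4k+3] ⟩
    5 ℕ.+ (4 * k ℕ.+ 3) ℕ.∸ 5 ℕ.+ 1     ≡⟨ cong (ℕ._+ 1) (ℕP.m+n∸m≡n 5 (4 * k ℕ.+ 3)) ⟩
    4 * k ℕ.+ 3 ℕ.+ 1                   ≡⟨ solve (k ∷ []) ℕ-ring ⟩
    2 * suc k ℕ.+ 2 * suc k             ∎
    where
    open ≡-Reasoning
    4m≡5+[4k+3] : 4 * suc (suc k) ≡ 5 ℕ.+ (4 * k ℕ.+ 3)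
    4m≡5+[4k+3] = solve (k ∷ []) ℕ-ring

  dℚ+1≡K+K : dℚ ℚ.+ 1ℚ ≡ ι (+ K) ℚ.+ ι (+ K)
  dℚ+1≡K+K = begin
    dℚ ℚ.+ ι (+ 1)                 ≡⟨ ι-+ℕ (dOf (suc (suc k))) 1 ⟨
    ι (+ (dOf (suc (suc k)) ℕ.+ 1)) ≡⟨ cong (λ t → ι (+ t)) d+1≡K+K ⟩
    ι (+ (K ℕ.+ K))                ≡⟨ ι-+ℕ K K ⟩
    ι (+ K) ℚ.+ ι (+ K)            ∎
    where open ≡-Reasoning

  n≡K+K+3 : ∀ n → suc n ≡ 4 * suc (suc k) → n ≡ K ℕ.+ K ℕ.+ 3
  n≡K+K+3 n eq = ℕP.suc-injective (trans eq 4m≡1+[K+K+3])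
    where
    4m≡1+[K+K+3] : 4 * suc (suc k) ≡ suc (2 * suc k ℕ.+ 2 * suc k ℕ.+ 3)
    4m≡1+[K+K+3] = solve (k ∷ []) ℕ-ring

  bVal-unimodular : ∀ sgn → bVal (suc (suc k)) sgn *C conj (bVal (suc (suc k)) sgn) ≡ oneC
  bVal-unimodular true  = cong₂ _,_ (unimodular-re dℚ (ι (+ K)) u u dℚ+1≡K+K K*u≡1 refl)
                                    (unimodular-im (ι -[1+ 0 ] ℚ.+ u) u)
  bVal-unimodular false = cong₂ _,_ (unimodular-re dℚ (ι (+ K)) u (ℚ.- u) dℚ+1≡K+K K*u≡1 (neg-squared u))
                                    (unimodular-im (ι -[1+ 0 ] ℚ.+ u) (ℚ.- u))
    where
    neg-squared : ∀ v → ℚ.- v ℚ.* ℚ.- v ≡ v ℚ.* v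
    neg-squared = solve-∀ ℚ-ring

  bVal-trace : ∀ n → suc n ≡ 4 * suc (suc k) → ∀ sgn →
    (embℤ (+ n) +C negC (embℤ (+ 3))) *C (bVal (suc (suc k)) sgn +C conj (bVal (suc (suc k)) sgn))
    ≡ embℤ (+ 2) *C (embℤ (+ 5) +C negC (embℤ (+ n)))
  bVal-trace n eq sgn = begin
    embℚ (ι (+ n) ℚ.- ι (+ 3)) *C ((r , v) +C conj (r , v))  ≡⟨ cong (embℚ (ι (+ n) ℚ.- ι (+ 3)) *C_) (+C-conj r v) ⟩
    embℚ (ι (+ n) ℚ.- ι (+ 3)) *C embℚ (r ℚ.+ r)             ≡⟨ embℚ-* (ι (+ n) ℚ.- ι (+ 3)) (r ℚ.+ r) ⟩
    embℚ ((ι (+ n) ℚ.- ι (+ 3)) ℚ.* (r ℚ.+ r))               ≡⟨ cong embℚ (trace-re (ι (+ n)) (ι (+ K)) u ιn≡K+K+3 K*u≡1) ⟩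
    embℚ (ι (+ 2) ℚ.* (ι (+ 5) ℚ.- ι (+ n)))                  ≡⟨ embℚ-* (ι (+ 2)) (ι (+ 5) ℚ.- ι (+ n)) ⟨
    embℤ (+ 2) *C (embℤ (+ 5) +C negC (embℤ (+ n)))           ∎
    where
    open ≡-Reasoning
    r v : ℚ
    r = ι -[1+ 0 ] ℚ.+ u
    v = (if sgn then + 1 else -[1+ 0 ]) ℚ./ K

    ιn≡K+K+3 : ι (+ n) ≡ ι (+ K) ℚ.+ ι (+ K) ℚ.+ ι (+ 3)
    ιn≡K+K+3 = begin
      ι (+ n)                                ≡⟨ cong (λ t → ι (+ t)) (n≡K+K+3 n eq) ⟩
      ι (+ (K ℕ.+ K ℕ.+ 3))                  ≡⟨ ι-+ℕ (K ℕ.+ K) 3 ⟩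
      ι (+ (K ℕ.+ K)) ℚ.+ ι (+ 3)            ≡⟨ cong (ℚ._+ ι (+ 3)) (ι-+ℕ K K) ⟩
      ι (+ K) ℚ.+ ι (+ K) ℚ.+ ι (+ 3)        ∎

module Construction (m n : ℕ) (sgn : Bool) (H : RMat (suc n)) (±1 : ∀ i j → H i j ≡ + 1 ⊎ H i j ≡ -[1+ 0 ]) where
  open Quad (dOf m)
  open QuadraticRing (dOf m)

  b : ℚ√- (dOf m)
  b = bVal m sgn

  M : Fin n → Fin n → ℚ√- (dOf m)
  M = construct m n sgn H

  P Q P̄ Q̄ : ℚ√- (dOf m)
  P = oneC +C b
  Q = oneC +C negC b
  P̄ = oneC +C conj b
  Q̄ = oneC +C negC (conj b)

  diagonal+ : ∀ β z → z ≡ + 1 →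
    embℤ (+ 2) *C negC β ≡ ((oneC +C β) *C embℤ -[1+ 0 ]) +C ((oneC +C negC β) *C embℤ z)
  diagonal+ β _ refl = ℚ√-Solver.solve 1 (λ β →
    κ (+ 2) ⊗ ⊝ β ⊜ (κ (+ 1) ⊕ β) ⊗ κ -[1+ 0 ] ⊕ (κ (+ 1) ⊕ ⊝ β) ⊗ κ (+ 1)) refl β

  diagonal- : ∀ β z → z ≡ -[1+ 0 ] →
    embℤ (+ 2) *C embℤ z ≡ ((oneC +C β) *C embℤ -[1+ 0 ]) +C ((oneC +C negC β) *C embℤ z)
  diagonal- β _ refl = ℚ√-Solver.solve 1 (λ β →
    κ (+ 2) ⊗ κ -[1+ 0 ] ⊜ (κ (+ 1) ⊕ β) ⊗ κ -[1+ 0 ] ⊕ (κ (+ 1) ⊕ ⊝ β) ⊗ κ -[1+ 0 ]) refl β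

  offDiagonal+ : ∀ β z → z ≡ + 1 →
    embℤ (+ 2) *C embℤ z ≡ ((oneC +C β) *C embℤ (+ 1)) +C ((oneC +C negC β) *C embℤ z)
  offDiagonal+ β _ refl = ℚ√-Solver.solve 1 (λ β →
    κ (+ 2) ⊗ κ (+ 1) ⊜ (κ (+ 1) ⊕ β) ⊗ κ (+ 1) ⊕ (κ (+ 1) ⊕ ⊝ β) ⊗ κ (+ 1)) refl β

  offDiagonal- : ∀ β z → z ≡ -[1+ 0 ] →
    embℤ (+ 2) *C β ≡ ((oneC +C β) *C embℤ (+ 1)) +C ((oneC +C negC β) *C embℤ z)
  offDiagonal- β _ refl = ℚ√-Solver.solve 1 (λ β →
    κ (+ 2) ⊗ β ⊜ (κ (+ 1) ⊕ β) ⊗ κ (+ 1) ⊕ (κ (+ 1) ⊕ ⊝ β) ⊗ κ -[1+ 0 ]) refl β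

  twice-construct : ∀ i k → embℤ (+ 2) *C M i k ≡ (P *C embℤ (J-2I i k)) +C (Q *C embℤ (core H i k))
  twice-construct i k with i Fin.≟ k | H (suc i) (suc k) ℤ.≟ + 1 | ±1 (suc i) (suc k)
  ... | yes _ | yes H≡1  | _          = diagonal+ b (core H i k) H≡1
  ... | yes _ | no  H≢1  | inj₁ H≡1   = ⊥-elim (H≢1 H≡1)
  ... | yes _ | no  _    | inj₂ H≡-1  = diagonal- b (core H i k) H≡-1
  ... | no  _ | yes H≡1  | _          = offDiagonal+ b (core H i k) H≡1
  ... | no  _ | no  H≢1  | inj₁ H≡1   = ⊥-elim (H≢1 H≡1)
  ... | no  _ | no  _    | inj₂ H≡-1  = offDiagonal- b (core H i k) H≡-1

  twice-conj-construct : ∀ i k → embℤ (+ 2) *C conj (M i k) ≡ (P̄ *C embℤ (J-2I i k)) +C (Q̄ *C embℤ (core H i k))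
  twice-conj-construct i k = begin
    embℤ (+ 2) *C conj (M i k)                                     ≡⟨ conj-*C (embℤ (+ 2)) (M i k) ⟨
    conj (embℤ (+ 2) *C M i k)                                     ≡⟨ cong conj (twice-construct i k) ⟩
    conj ((P *C embℤ (J-2I i k)) +C (Q *C embℤ (core H i k)))      ≡⟨ conj-linear P Q (J-2I i k) (core H i k) ⟩
    (conj P *C embℤ (J-2I i k)) +C (conj Q *C embℤ (core H i k))
      ≡⟨ cong₂ (λ p q → (p *C embℤ (J-2I i k)) +C (q *C embℤ (core H i k))) (conj-+C oneC b) (conj-+C oneC (negC b)) ⟩
    (P̄ *C embℤ (J-2I i k)) +C (Q̄ *C embℤ (core H i k))             ∎
    where open ≡-Reasoning

  construct-unimodular : b *C conj b ≡ oneC → ∀ i j → M i j *C conj (M i j) ≡ oneC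
  construct-unimodular b-unimodular i j with i Fin.≟ j | H (suc i) (suc j) ℤ.≟ + 1
  ... | yes _ | yes _ = trans (negC-*C-negC b (conj b)) b-unimodular
  ... | yes _ | no  _ = embℤ-±1-unimodular (core H i j) (±1 (suc i) (suc j))
  ... | no  _ | yes _ = embℤ-±1-unimodular (core H i j) (±1 (suc i) (suc j))
  ... | no  _ | no  _ = b-unimodular

  construct-rowNorm : b *C conj b ≡ oneC → ∀ i → sumC n (λ k → M i k *C conj (M i k)) ≡ embℤ (+ n)
  construct-rowNorm b-unimodular i = begin
    sumC n (λ k → M i k *C conj (M i k))   ≡⟨ sumC-cong n (construct-unimodular b-unimodular i) ⟩
    sumC n (λ _ → embℤ (+ 1))              ≡⟨ embℤ-sumℤ n (λ _ → + 1) ⟨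
    embℤ (sumℤ n (λ _ → + 1))              ≡⟨ cong embℤ (sumℤ-ones n) ⟩
    embℤ (+ n)                             ∎
    where open ≡-Reasoning

  construct-orthogonal : b *C conj b ≡ oneC →
    (embℤ (+ n) +C negC (embℤ (+ 3))) *C (b +C conj b) ≡ embℤ (+ 2) *C (embℤ (+ 5) +C negC (embℤ (+ n))) →
    (∀ i j → core H i j ≡ core H j i) → (∀ i → sumℤ n (core H i) ≡ -[1+ 0 ]) →
    (∀ {i j} → i ≢ j → core H i · core H j ≡ -[1+ 0 ]) →
    ∀ i j → i ≢ j → sumC n (λ k → M i k *C conj (M j k)) ≡ zeroC
  construct-orthogonal b-unimodular b-trace symmetric rowSum orthogonal i j i≢j = embℤ-suc-*C-cancel 3 _ (begin
    embℤ (+ 4) *C sumC n (λ k → M i k *C conj (M j k))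
      ≡⟨ sumC-*Cˡ n (embℤ (+ 4)) (λ k → M i k *C conj (M j k)) ⟨
    sumC n (λ k → embℤ (+ 4) *C (M i k *C conj (M j k)))
      ≡⟨ sumC-cong n (λ k → trans (four≡two*two (M i k) (conj (M j k)))
                                  (cong₂ _*C_ (twice-construct i k) (twice-conj-construct j k))) ⟩
    sumC n (λ k → ((P *C embℤ (J-2I i k)) +C (Q *C embℤ (x i k))) *C ((P̄ *C embℤ (J-2I j k)) +C (Q̄ *C embℤ (x j k))))
      ≡⟨ sumC-bilinear n P Q P̄ Q̄ (J-2I i) (x i) (J-2I j) (x j) ⟩
    ((P *C P̄) *C embℤ (J-2I i · J-2I j)) +C (((P *C Q̄) *C embℤ (J-2I i · x j))
      +C (((Q *C P̄) *C embℤ (x i · J-2I j)) +C ((Q *C Q̄) *C embℤ (x i · x j))))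
      ≡⟨ cong₂ (λ A C → ((P *C P̄) *C A) +C (((P *C Q̄) *C embℤ (J-2I i · x j))
                         +C (((Q *C P̄) *C C) +C ((Q *C Q̄) *C embℤ (x i · x j)))))
               (trans (cong embℤ (J-2I-·-J-2I n i≢j)) (embℤ-+ (+ n) -[1+ 3 ]))
               (cong embℤ (sym (J-2I-·-symmetric n x symmetric rowSum i j))) ⟩
    ((P *C P̄) *C (embℤ (+ n) +C embℤ -[1+ 3 ])) +C (((P *C Q̄) *C embℤ (J-2I i · x j))
      +C (((Q *C P̄) *C embℤ (J-2I i · x j)) +C ((Q *C Q̄) *C embℤ (x i · x j))))
      ≡⟨ cong (λ C → ((P *C P̄) *C (embℤ (+ n) +C embℤ -[1+ 3 ])) +C (((P *C Q̄) *C embℤ (J-2I i · x j))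
                       +C (((Q *C P̄) *C embℤ (J-2I i · x j)) +C ((Q *C Q̄) *C embℤ C))))
              (orthogonal i≢j) ⟩
    ((P *C P̄) *C (embℤ (+ n) +C embℤ -[1+ 3 ])) +C (((P *C Q̄) *C embℤ (J-2I i · x j))
      +C (((Q *C P̄) *C embℤ (J-2I i · x j)) +C ((Q *C Q̄) *C embℤ -[1+ 0 ])))
      ≡⟨ orthogonality-identity b (embℤ (+ n)) (embℤ (J-2I i · x j)) b-unimodular b-trace ⟩
    zeroC ∎)
    where
    open ≡-Reasoning
    x = core H
    four≡two*two : ∀ y z → embℤ (+ 4) *C (y *C z) ≡ (embℤ (+ 2) *C y) *C (embℤ (+ 2) *C z)
    four≡two*two = ℚ√-Solver.solve 2 (λ y z → κ (+ 4) ⊗ (y ⊗ z) ⊜ (κ (+ 2) ⊗ y) ⊗ (κ (+ 2) ⊗ z)) refl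

theorem3 : (m n : ℕ) → 2 ≤ m → suc n ≡ 4 * m →
    (H : RMat (suc n)) →
    IsRealHadamard (suc n) H → IsSymmetric (suc n) H → IsNormalized n H →
    (sgn : Bool) →
    Quad.IsComplexHadamard (dOf m) n (construct m n sgn H)
theorem3 (suc (suc k)) n (s≤s (s≤s z≤n)) n+1≡4m H hadamard symmetric normalized sgn =
    construct-unimodular (bVal-unimodular sgn)
  , construct-rowNorm (bVal-unimodular sgn)
  , construct-orthogonal (bVal-unimodular sgn) (bVal-trace n n+1≡4m sgn) (λ i j → symmetric (suc i) (suc j))
                         (core-rowSum hadamard normalized) (core-orthogonal hadamard normalized)
  where
  open Parameter k
  open Construction (suc (suc k)) n sgn H (proj₁ hadamard)
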